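{- Let $G$ be a Frobenius instance with parameter $k$, with parts $V_1,\dots,V_\ell$ and corresponding weights $w_1,\dots,w_\ell$. Then $G$ has a closed set of weight $k$ if and only if $\gcd(w_1,\dots,w_\ell)$ divides $k$.
   Context: For a directed graph $G=(V,E)$, a set $S\subseteq V$ is closed if for every edge $(u,v)\in E$, $u\in S$ implies $v\in S$. $D(v)$ denotes the set of descendants of $v$ (vertices reachable from $v$ by a directed path, including $v$ itself). For node weights $w:V\to\mathbb{N}$ and $S\subseteq V$, $w(S)=\sum_{v\in S}w(v)$ is the weight of $S$. A Frobenius instance with parameter $k$ is a weighted directed graph $G=(V,E,w)$ with vertex set partitioned into $\ell$ parts $V=V_1\cup\dots\cup V_\ell$ and $w:V\to\mathbb{N}$ such that: (P1) there are weights $w_1,\dots,w_\ell$ with $w(v)=w_i$ for all $v\in V_i$, $i\in[\ell]$; (P2) for every edge $(u,v)\in E$ we have $u\in V_i$, $v\in V_j$ for some $\ell\ge i>j\ge1$; (P3) $|V_i|\ge k$ for all $i\in[\ell]$; (P4) $w(D(v))\le\sqrt{k/2}$ for all $v\in V$. -}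

module Defs where

open import Data.Nat using (ℕ; zero; suc; _+_; _*_; _≤_; _<_)
open import Data.Nat.GCD using (gcd)
open import Data.Nat.Divisibility using (_∣_)
open import Data.Bool using (Bool; true; false; if_then_else_)
open import Data.Fin using (Fin; toℕ)
open import Data.Fin.Properties using (_≟_)
open import Data.Fin.Subset using (Subset; _∈_)
open import Data.Vec using (lookup)
open import Data.Nat.ListAction using (sum)
open import Data.List using (List; map; length; filter; foldr)
open import Data.List.Base using (allFin)
open import Data.Product using (_×_)
open import Relation.Binary.PropositionalEquality using (_≡_)
open import Relation.Binary.Construct.Closure.ReflexiveTransitive using (Star)
open import Function.Bundles using (_⇔_)

-- A weighted directed graph on vertex set Fin n, with a partition into
-- ℓ parts (part v = i means v ∈ V_{i+1}) and per-part weights.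
record PartitionedGraph (n ℓ : ℕ) : Set where
  field
    edge   : Fin n → Fin n → Bool
    part   : Fin n → Fin ℓ
    pw     : Fin ℓ → ℕ

  E : Fin n → Fin n → Set
  E u v = edge u v ≡ true

  -- (P1) holds by construction: w(v) = w_{part v}
  w : Fin n → ℕ
  w v = pw (part v)

  Reach : Fin n → Fin n → Set
  Reach = Star E

  weight : Subset n → ℕ
  weight S = sum (map (λ v → if lookup S v then w v else 0) (allFin n))

  Closed : Subset n → Set
  Closed S = ∀ u v → E u v → u ∈ S → v ∈ S

  IsDesc : Fin n → Subset n → Set
  IsDesc v S = ∀ u → (u ∈ S ⇔ Reach v u)

  partSize : Fin ℓ → ℕ
  partSize i = length (filter (λ v → part v ≟ i) (allFin n))

  -- gcd(w_1, …, w_ℓ)  (gcd of the empty list is 0)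
  gcdW : ℕ
  gcdW = foldr gcd 0 (map pw (allFin ℓ))

open PartitionedGraph public

-- Frobenius instance with parameter k.
-- (P4) w(D(v)) ≤ √(k/2) is stated as 2·w(D(v))² ≤ k, equivalent since
-- w(D(v)) is a natural number.
record IsFrobenius {n ℓ : ℕ} (G : PartitionedGraph n ℓ) (k : ℕ) : Set where
  field
    P2 : ∀ u v → E G u v → toℕ (part G v) < toℕ (part G u)
    P3 : ∀ i → k ≤ partSize G i
    P4 : ∀ v S → IsDesc G v S → 2 * (weight G S * weight G S) ≤ k

-- Necessity: gcd(w₁,…,w_ℓ) divides every vertex weight. For sufficiency, settle the
-- parts from the top down, keeping a closed set Y such that k − w(Y) is a multiple of
-- gⱼ = gcd(w₁,…,wⱼ), where g₀ = 0. To pass from gⱼ to gⱼ₋₁, Bézout gives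
-- c < gⱼ₋₁ / gⱼ with k − w(Y) ≡ c·wⱼ (mod gⱼ₋₁); add D(x) for c vertices x ∈ Vⱼ \ Y.
-- Each addition raises w(Y) by wⱼ plus a multiple of gⱼ₋₁, as the rest of D(x) lies
-- in lower parts, and (P3) provides such x while w(Y) < k. Every D(x) weighs at most
-- β with β² ≤ k by (P4), and fewer than gⱼ / g_ℓ ≤ β sets are ever added, so w(Y)
-- never overshoots k; at j = 0 the remainder is a multiple of 0.

module Submission where

open import Defs
open import Data.Nat using (ℕ)
open import Data.Nat.Divisibility using (_∣_)
open import Data.Fin.Subset using (Subset)
open import Data.Product using (Σ; _×_)
open import Relation.Binary.PropositionalEquality using (_≡_)
open import Function.Bundles using (_⇔_)

open import Data.Bool.Base using (Bool; true; false; if_then_else_; not; _∧_; _∨_; T)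
open import Data.Bool.Properties using (T-≡; T-∧; T-∨; T-not-≡; ¬-not) renaming (_≟_ to _≟ᵇ_)
open import Data.Fin.Base using (Fin; zero; suc; toℕ; fromℕ<; punchIn)
open import Data.Fin.Properties using (_≟_; any?; toℕ<n; toℕ-fromℕ<; fromℕ<-toℕ; fromℕ<-cong; punchInᵢ≢i)
open import Data.Fin.Subset using (_∈_)
open import Data.List.Base as List using ([]; _∷_; map; filter; length; foldr; allFin)
open import Data.List.Extrema.Nat using (max; xs≤max; argmax-all)
open import Data.List.Membership.Propositional.Properties using (∈-tabulate⁺; ∈-map⁺; ∈-allFin)
open import Data.List.Relation.Unary.All as All using (All; []; _∷_)
open import Data.List.Relation.Unary.All.Properties using (tabulate⁺; map⁺)
open import Data.Nat.Base using (zero; suc; _+_; _*_; _∸_; _≤_; _<_; z≤n; s≤s; z<s; NonZero; ≢-nonZero; >-nonZero; ≢-nonZero⁻¹; _≤′_; ≤′-refl; ≤′-step)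
open import Data.Nat.DivMod using (_%_; _/_; m≡m%n+[m/n]*n; [m+kn]%n≡m%n; %-distribˡ-*; m%n<n)
open import Data.Nat.Divisibility using (divides; module _∣_; ∣-refl; ∣-trans; _∣0; ∣m∣n⇒∣m+n; 0∣⇒≡0; ∣⇒≤)
open import Data.Nat.GCD using (gcd; gcd[m,n]∣m; gcd[m,n]∣n; gcd-greatest; gcd[m,n]≢0; gcd-identityˡ; gcd-identityʳ; gcd-GCD; module Bézout)
open import Data.Nat.ListAction using (sum)
open import Data.Nat.Properties renaming (_≟_ to _≟ℕ_)
open import Algebra.Properties.CommutativeMonoid.Sum +-0-commutativeMonoid
  using (sum-remove; sum-cong-≗; sum-replicate-zero; ∑-distrib-+) renaming (sum to ∑)
open import Data.Nat.Tactic.RingSolver using (solve-∀)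
open import Data.Product using (_,_; proj₁; proj₂)
open import Data.Sum as Sum using (inj₁; inj₂)
open import Data.Vec.Base as Vec using ()
open import Data.Vec.Properties using (lookup∘tabulate; []=⇒lookup; lookup⇒[]=)
open import Function.Base using (_∘_; id)
open import Function.Bundles using (mk⇔; Equivalence)
open import Relation.Binary.Construct.Closure.ReflexiveTransitive using (ε; _◅_; _◅◅_)
open import Relation.Binary.PropositionalEquality using (refl; sym; trans; cong; cong₂; subst; subst₂; _≢_; ≢-sym; module ≡-Reasoning)
open import Relation.Nullary using (Dec; yes; no; isYes; contradiction; map′; _×-dec_)
open import Relation.Nullary.Decidable using (toWitness; fromWitness)
open import Relation.Unary using (Pred; Decidable)

open Bézout using (+-; -+)
open Equivalence using (to; from)

∑-mono-≤ : ∀ {m} {f g : Fin m → ℕ} → (∀ i → f i ≤ g i) → ∑ f ≤ ∑ g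
∑-mono-≤ {zero}  _   = z≤n
∑-mono-≤ {suc m} f≤g = +-mono-≤ (f≤g zero) (∑-mono-≤ (f≤g ∘ suc))

∑-∣ : ∀ {m d} {f : Fin m → ℕ} → (∀ i → d ∣ f i) → d ∣ ∑ f
∑-∣ {zero}  _   = _ ∣0
∑-∣ {suc m} d∣f = ∣m∣n⇒∣m+n (d∣f zero) (∑-∣ (d∣f ∘ suc))

∑-remove-∣ : ∀ {m d} (f : Fin m → ℕ) i → (∀ j → j ≢ i → d ∣ f j) →
             Σ ℕ λ e → ∑ f ≡ f i + e × d ∣ e
∑-remove-∣ {suc m} f i d∣f =
  ∑ (f ∘ punchIn i) , sum-remove {i = i} f ,
  ∑-∣ λ j → d∣f (punchIn i j) (punchInᵢ≢i i j)

f≤∑ : ∀ {m} (f : Fin m → ℕ) i → f i ≤ ∑ f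
f≤∑ {suc m} f i = subst (f i ≤_) (sym (sum-remove {i = i} f)) (m≤m+n (f i) _)

sum-map-tabulate : ∀ {A : Set} {m} (f : A → ℕ) (g : Fin m → A) →
                   sum (map f (List.tabulate g)) ≡ ∑ (f ∘ g)
sum-map-tabulate {m = zero}  f g = refl
sum-map-tabulate {m = suc m} f g = cong (f (g zero) +_) (sum-map-tabulate f (g ∘ suc))

*-length-filter≤sum : ∀ {A : Set} {p} {P : Pred A p} (P? : Decidable P) (f : A → ℕ) {b} →
                      (∀ x → P x → b ≤ f x) →
                      ∀ xs → b * length (filter P? xs) ≤ sum (map f xs)
*-length-filter≤sum P? f {b} b≤f [] = ≤-reflexive (*-zeroʳ b)
*-length-filter≤sum P? f {b} b≤f (x ∷ xs) with P? x
... | yes px = begin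
  b * suc (length (filter P? xs))   ≡⟨ *-suc b _ ⟩
  b + b * length (filter P? xs)     ≤⟨ +-mono-≤ (b≤f x px) (*-length-filter≤sum P? f b≤f xs) ⟩
  f x + sum (map f xs)              ∎
  where open ≤-Reasoning
... | no _ = ≤-trans (*-length-filter≤sum P? f b≤f xs) (m≤n+m _ (f x))

foldr-gcd-∣ : ∀ xs → All (foldr gcd 0 xs ∣_) xs
foldr-gcd-∣ []       = []
foldr-gcd-∣ (x ∷ xs) =
  gcd[m,n]∣m x _ ∷ All.map (∣-trans (gcd[m,n]∣n x _)) (foldr-gcd-∣ xs)

∣-foldr-gcd : ∀ {d xs} → All (d ∣_) xs → d ∣ foldr gcd 0 xs
∣-foldr-gcd []         = _ ∣0
∣-foldr-gcd (d∣x ∷ ds) = gcd-greatest d∣x (∣-foldr-gcd ds)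

prefixGcd : (ℕ → ℕ) → ℕ → ℕ
prefixGcd f zero    = 0
prefixGcd f (suc j) = gcd (prefixGcd f j) (f j)

prefixGcd-∣ : ∀ f {i j} → i < j → prefixGcd f j ∣ f i
prefixGcd-∣ f {j = suc j} (s≤s i≤j) with m≤n⇒m<n∨m≡n i≤j
... | inj₁ i<j  = ∣-trans (gcd[m,n]∣m (prefixGcd f j) (f j)) (prefixGcd-∣ f i<j)
... | inj₂ refl = gcd[m,n]∣n (prefixGcd f j) (f j)

prefixGcd-antitone : ∀ f {i j} → i ≤ j → prefixGcd f j ∣ prefixGcd f i
prefixGcd-antitone f = go ∘ ≤⇒≤′
  where
  go : ∀ {i j} → i ≤′ j → prefixGcd f j ∣ prefixGcd f i
  go ≤′-refl      = ∣-refl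
  go (≤′-step {n = j} i≤j) = ∣-trans (gcd[m,n]∣m (prefixGcd f j) (f j)) (go i≤j)

prefixGcd-≤ : ∀ f {b} j → (∀ i → i < j → f i ≤ b) → 0 < prefixGcd f j → prefixGcd f j ≤ b
prefixGcd-≤ f zero    _   ()
prefixGcd-≤ f (suc j) f≤b pos with f j in fj≡
... | zero  = subst (_≤ _) (sym (gcd-identityʳ _)) (prefixGcd-≤ f j
                (λ i → f≤b i ∘ m<n⇒m<1+n) (subst (0 <_) (gcd-identityʳ _) pos))
... | suc a = ≤-trans (∣⇒≤ (gcd[m,n]∣n (prefixGcd f j) (suc a)))
                (subst (_≤ _) fj≡ (f≤b j ≤-refl))

∣∧≤⇒≡+* : ∀ {d e M} → d ∣ e → (0 < d → e ≤ M * d) → Σ ℕ λ M′ → M * d ≡ e + M′ * d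
∣∧≤⇒≡+* {zero} {M = M} d∣e _ = M , cong (_+ M * 0) (sym (0∣⇒≡0 d∣e))
∣∧≤⇒≡+* {d@(suc _)} {M = M} (divides q e≡qd) e≤Md = M ∸ q , (begin
  M * d                ≡⟨ cong (_* d) (m+[n∸m]≡n q≤M) ⟨
  (q + (M ∸ q)) * d    ≡⟨ *-distribʳ-+ d q (M ∸ q) ⟩
  q * d + (M ∸ q) * d  ≡⟨ cong (_+ (M ∸ q) * d) e≡qd ⟨
  _ + (M ∸ q) * d      ∎)
  where
  open ≡-Reasoning
  q≤M : q ≤ M
  q≤M = *-cancelʳ-≤ q M d (subst (_≤ M * d) e≡qd (e≤Md z<s))

%≡∧≤⇒≡+* : ∀ {x y} n .{{_ : NonZero n}} → x % n ≡ y % n → x ≤ y →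
           Σ ℕ λ M → y ≡ x + M * n
%≡∧≤⇒≡+* {x} {y} n x≡y x≤y = y / n ∸ x / n , (begin
  y                                      ≡⟨ y≡ ⟩
  x % n + y / n * n                      ≡⟨ cong (λ q → x % n + q * n) (m+[n∸m]≡n x/n≤y/n) ⟨
  x % n + (x / n + (y / n ∸ x / n)) * n  ≡⟨ rearrange (x % n) (x / n) (y / n ∸ x / n) n ⟩
  x % n + x / n * n + (y / n ∸ x / n) * n ≡⟨ cong (_+ (y / n ∸ x / n) * n) (m≡m%n+[m/n]*n x n) ⟨
  x + (y / n ∸ x / n) * n                ∎)
  where
  open ≡-Reasoning
  rearrange : ∀ r a b n → r + (a + b) * n ≡ r + a * n + b * n
  rearrange = solve-∀
  y≡ : y ≡ x % n + y / n * n
  y≡ = trans (m≡m%n+[m/n]*n y n) (cong (_+ y / n * n) (sym x≡y))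
  x/n≤y/n : x / n ≤ y / n
  x/n≤y/n = *-cancelʳ-≤ (x / n) (y / n) n
    (+-cancelˡ-≤ (x % n) _ _ (subst₂ _≤_ (m≡m%n+[m/n]*n x n) y≡ x≤y))

gcd≡*-mod : ∀ n a .{{_ : NonZero n}} → Σ ℕ λ c → c * a % n ≡ gcd n a % n
gcd≡*-mod n@(suc n₀) a with Bézout.identity (gcd-GCD n a)
... | -+ x y eq = y , (begin
  y * a % n                ≡⟨ cong (_% n) eq ⟨
  (gcd n a + x * n) % n    ≡⟨ [m+kn]%n≡m%n (gcd n a) x n ⟩
  gcd n a % n              ∎)
  where open ≡-Reasoning
-- Here y·(n − 1)·a ≡ −y·a ≡ gcd n a (mod n).
... | +- x y eq = y * n₀ , (begin
  y * n₀ * a % n                        ≡⟨ [m+kn]%n≡m%n (y * n₀ * a) x n ⟨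
  (y * n₀ * a + x * n) % n              ≡⟨ cong (λ t → (y * n₀ * a + t) % n) eq ⟨
  (y * n₀ * a + (gcd n a + y * a)) % n  ≡⟨ cong (_% n) (rearrange (gcd n a) y n₀ a) ⟩
  (gcd n a + y * a * n) % n             ≡⟨ [m+kn]%n≡m%n (gcd n a) (y * a) n ⟩
  gcd n a % n                           ∎)
  where
  open ≡-Reasoning
  rearrange : ∀ g y n₀ a → y * n₀ * a + (g + y * a) ≡ g + y * a * suc n₀
  rearrange = solve-∀

gcd-residue< : ∀ n a m .{{_ : NonZero n}} →
               Σ ℕ λ c → suc c * gcd n a ≤ n × c * a % n ≡ m * gcd n a % n
gcd-residue< n a m with gcd[m,n]∣m n a | gcd[m,n]∣n n a | gcd≡*-mod n a
... | divides zero n≡0 | _ | _ = contradiction n≡0 (≢-nonZero⁻¹ n)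
-- Reducing m·c₀ modulo r = n / gcd n a changes c·a by a multiple of r·a = s·n.
... | divides r@(suc _) n≡rg | divides s a≡sg | c₀ , c₀a≡g = c , bound , congruence
  where
  g = gcd n a
  c = m * c₀ % r
  q = m * c₀ / r
  bound : suc c * g ≤ n
  bound = subst (suc c * g ≤_) (sym n≡rg) (*-monoˡ-≤ g (m%n<n (m * c₀) r))
  open ≡-Reasoning
  split : c * a + q * s * n ≡ m * c₀ * a
  split = begin
    c * a + q * s * n                ≡⟨ cong₂ (λ a n → c * a + q * s * n) a≡sg n≡rg ⟩
    c * (s * g) + q * s * (r * g)    ≡⟨ regroup c q s r g ⟩
    (c + q * r) * (s * g)            ≡⟨ cong₂ _*_ (m≡m%n+[m/n]*n (m * c₀) r) a≡sg ⟨
    m * c₀ * a                       ∎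
    where
    regroup : ∀ c q s r g → c * (s * g) + q * s * (r * g) ≡ (c + q * r) * (s * g)
    regroup = solve-∀
  congruence : c * a % n ≡ m * g % n
  congruence = begin
    c * a % n                       ≡⟨ [m+kn]%n≡m%n (c * a) (q * s) n ⟨
    (c * a + q * s * n) % n         ≡⟨ cong (_% n) split ⟩
    m * c₀ * a % n                  ≡⟨ cong (_% n) (*-assoc m c₀ a) ⟩
    m * (c₀ * a) % n                ≡⟨ %-distribˡ-* m (c₀ * a) n ⟩
    m % n * (c₀ * a % n) % n        ≡⟨ cong (λ t → m % n * t % n) c₀a≡g ⟩
    m % n * (g % n) % n             ≡⟨ %-distribˡ-* m g n ⟨
    m * g % n                       ∎

gcd-residue : ∀ n a m → Σ ℕ λ c → (0 < n → suc c * gcd n a ≤ n) ×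
              ((0 < n → c * a ≤ m * gcd n a) → Σ ℕ λ M → m * gcd n a ≡ c * a + M * n)
gcd-residue zero a m =
  m , (λ ()) , λ _ → 0 , trans (cong (m *_) (gcd-identityˡ a)) (sym (+-identityʳ _))
gcd-residue n@(suc _) a m with gcd-residue< n a m
... | c , bound , congruence =
  c , (λ _ → bound) , λ c*a≤m*g → %≡∧≤⇒≡+* n congruence (c*a≤m*g z<s)

∅ : ∀ {n} → Fin n → Bool
∅ _ = false

_∪_ _∖_ : ∀ {n} → (Fin n → Bool) → (Fin n → Bool) → Fin n → Bool
(Y ∪ Z) v = Y v ∨ Z v
(Z ∖ Y) v = not (Y v) ∧ Z v

module Weighted {n : ℕ} (w : Fin n → ℕ) where

  share : (Fin n → Bool) → Fin n → ℕ
  share Y v = if Y v then w v else 0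

  wt : (Fin n → Bool) → ℕ
  wt Y = ∑ (share Y)

  wt-∅ : wt ∅ ≡ 0
  wt-∅ = sum-replicate-zero n

  share-T : ∀ Y {v} → T (Y v) → share Y v ≡ w v
  share-T Y {v} v∈Y with Y v
  ... | true = refl

  share-∣ : ∀ {d} Y v → (T (Y v) → d ∣ w v) → d ∣ share Y v
  share-∣ Y v d∣w with Y v
  ... | true  = d∣w _
  ... | false = _ ∣0

  w≤wt : ∀ Y {v} → T (Y v) → w v ≤ wt Y
  w≤wt Y {v} v∈Y = subst (_≤ wt Y) (share-T Y v∈Y) (f≤∑ (share Y) v)

  wt-∪ : ∀ Y Z → wt (Y ∪ Z) ≡ wt Y + wt (Z ∖ Y)
  wt-∪ Y Z = trans (sum-cong-≗ split) (∑-distrib-+ (share Y) (share (Z ∖ Y)))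
    where
    split : ∀ v → share (Y ∪ Z) v ≡ share Y v + share (Z ∖ Y) v
    split v with Y v
    ... | true  = sym (+-identityʳ (w v))
    ... | false = refl

  wt-∖≤ : ∀ Z Y → wt (Z ∖ Y) ≤ wt Z
  wt-∖≤ Z Y = ∑-mono-≤ shrink
    where
    shrink : ∀ v → share (Z ∖ Y) v ≤ share Z v
    shrink v with Y v
    ... | true  = z≤n
    ... | false = ≤-refl

module Ranked {n ℓ : ℕ} (G : PartitionedGraph n ℓ)
  (descending : ∀ u v → E G u v → toℕ (part G v) < toℕ (part G u)) where

  rank : Fin n → ℕ
  rank v = toℕ (part G v)

  rank-≤ : ∀ {x v} → Reach G x v → rank v ≤ rank x
  rank-≤ ε       = ≤-refl
  rank-≤ (e ◅ r) = ≤-trans (rank-≤ r) (<⇒≤ (descending _ _ e))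

  rank-< : ∀ {x v} → Reach G x v → x ≢ v → rank v < rank x
  rank-< ε       x≢x = contradiction refl x≢x
  rank-< (e ◅ r) _   = ≤-<-trans (rank-≤ r) (descending _ _ e)

  first-step : ∀ {x v} → x ≢ v → Reach G x v → Σ (Fin n) λ y → E G x y × Reach G y v
  first-step x≢x ε       = contradiction refl x≢x
  first-step _   (e ◅ r) = _ , e , r

  -- Fuel beyond rank x suffices, since ranks drop along every edge.
  reach?′ : ∀ f x v → rank x < f → Dec (Reach G x v)
  reach?′ (suc f) x v (s≤s rx≤f) with x ≟ v
  ... | yes refl = yes ε
  ... | no x≢v   = map′ (λ (y , e , r) → e ◅ r) (first-step x≢v) (any? via)
    where
    via : ∀ y → Dec (E G x y × Reach G y v)
    via y with edge G x y ≟ᵇ true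
    ... | no ¬e = no (¬e ∘ proj₁)
    ... | yes e = map′ (e ,_) proj₂ (reach?′ f y v (≤-trans (descending x y e) rx≤f))

  reach? : ∀ x v → Dec (Reach G x v)
  reach? x v = reach?′ ℓ x v (toℕ<n (part G x))

  desc : Fin n → Fin n → Bool
  desc x v = isYes (reach? x v)

  Closedᵇ : (Fin n → Bool) → Set
  Closedᵇ Y = ∀ u v → E G u v → T (Y u) → T (Y v)

  desc-closed : ∀ x → Closedᵇ (desc x)
  desc-closed x u v e u∈D = fromWitness (toWitness u∈D ◅◅ (e ◅ ε))

  ∪-closed : ∀ {Y Z} → Closedᵇ Y → Closedᵇ Z → Closedᵇ (Y ∪ Z)
  ∪-closed Y-closed Z-closed u v e =
    T-∨ .from ∘ Sum.map (Y-closed u v e) (Z-closed u v e) ∘ T-∨ .to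

  toSubset : (Fin n → Bool) → Subset n
  toSubset = Vec.tabulate

  ∈-toSubset : ∀ Y v → v ∈ toSubset Y ⇔ T (Y v)
  ∈-toSubset Y v = mk⇔
    (λ v∈ → T-≡ .from (trans (sym (lookup∘tabulate Y v)) ([]=⇒lookup v∈)))
    (λ v∈ → lookup⇒[]= v (toSubset Y) (trans (lookup∘tabulate Y v) (T-≡ .to v∈)))

  toSubset-closed : ∀ Y → Closedᵇ Y → Closed G (toSubset Y)
  toSubset-closed Y Y-closed u v e u∈ =
    ∈-toSubset Y v .from (Y-closed u v e (∈-toSubset Y u .to u∈))

  toSubset-desc : ∀ x → IsDesc G x (toSubset (desc x))
  toSubset-desc x v =
    mk⇔ (toWitness ∘ ∈-toSubset (desc x) v .to) (∈-toSubset (desc x) v .from ∘ fromWitness)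

module Frobenius {n ℓ : ℕ} (G : PartitionedGraph n ℓ) (k : ℕ) (F : IsFrobenius G k) where

  open IsFrobenius F
  open Ranked G P2 public
  open Weighted (w G) public

  weight≡wt : ∀ S → weight G S ≡ wt (Vec.lookup S)
  weight≡wt S = sum-map-tabulate (share (Vec.lookup S)) id

  weight-toSubset : ∀ Y → weight G (toSubset Y) ≡ wt Y
  weight-toSubset Y = trans (weight≡wt (toSubset Y))
    (sum-cong-≗ λ v → cong (λ b → if b then w G v else 0) (lookup∘tabulate Y v))

  gcdW∣weight : ∀ S → gcdW G ∣ weight G S
  gcdW∣weight S = subst (gcdW G ∣_) (sym (weight≡wt S))
    (∑-∣ λ v → share-∣ (Vec.lookup S) v λ _ → gcdW∣w v)
    where
    gcdW∣w : ∀ v → gcdW G ∣ w G v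
    gcdW∣w v = All.lookup (foldr-gcd-∣ _) (∈-map⁺ (pw G) (∈-allFin (part G v)))

  β : ℕ
  β = max 0 (List.tabulate λ v → wt (desc v))

  wt-desc≤β : ∀ v → wt (desc v) ≤ β
  wt-desc≤β v = All.lookup (xs≤max 0 _) (∈-tabulate⁺ v)

  β*β≤k : β * β ≤ k
  β*β≤k = argmax-all id {P = λ t → t * t ≤ k} z≤n (tabulate⁺ λ v →
    ≤-trans (m≤m+n _ _)
      (subst (λ t → 2 * (t * t) ≤ k) (weight-toSubset (desc v)) (P4 v _ (toSubset-desc v))))

  w≤β : ∀ v → w G v ≤ β
  w≤β v = ≤-trans (w≤wt (desc v) (fromWitness ε)) (wt-desc≤β v)

  budget : ∀ {t} → t ≤ β → t * β ≤ k
  budget t≤β = ≤-trans (*-monoˡ-≤ β t≤β) β*β≤k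

  pwℕ : ℕ → ℕ
  pwℕ j with j <? ℓ
  ... | yes j<ℓ = pw G (fromℕ< j<ℓ)
  ... | no  _   = 0

  pwℕ-fromℕ< : ∀ {j} (j<ℓ : j < ℓ) → pwℕ j ≡ pw G (fromℕ< j<ℓ)
  pwℕ-fromℕ< {j} j<ℓ with j <? ℓ
  ... | yes j<ℓ′ = cong (pw G) (fromℕ<-cong j j refl j<ℓ′ j<ℓ)
  ... | no  j≮ℓ  = contradiction j<ℓ j≮ℓ

  pwℕ-toℕ : ∀ i → pwℕ (toℕ i) ≡ pw G i
  pwℕ-toℕ i = trans (pwℕ-fromℕ< (toℕ<n i)) (cong (pw G) (fromℕ<-toℕ i _))

  pwℕ-rank : ∀ v → pwℕ (rank v) ≡ w G v
  pwℕ-rank v = pwℕ-toℕ (part G v)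

  gcdBelow : ℕ → ℕ
  gcdBelow = prefixGcd pwℕ

  gcdBelow-ℓ∣gcdW : gcdBelow ℓ ∣ gcdW G
  gcdBelow-ℓ∣gcdW = ∣-foldr-gcd (map⁺ (tabulate⁺ λ i →
    subst (gcdBelow ℓ ∣_) (pwℕ-toℕ i) (prefixGcd-∣ pwℕ (toℕ<n i))))

  -- By (P3), a part of positive weight cannot lie inside a set lighter than k.
  unfilled-part : ∀ {j} Y → j < ℓ → 0 < pwℕ j → wt Y < k →
                  Σ (Fin n) λ x → rank x ≡ j × Y x ≡ false
  unfilled-part {j} Y j<ℓ a>0 wtY<k with any? (λ v → rank v ≟ℕ j ×-dec Y v ≟ᵇ false)
  ... | yes found = found
  ... | no  none  = contradiction full (<⇒≱ wtY<k)
    where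
    i = fromℕ< j<ℓ
    pwℕ≤share : ∀ v → part G v ≡ i → pwℕ j ≤ share Y v
    pwℕ≤share v v∈i = ≤-reflexive (begin
      pwℕ j      ≡⟨ pwℕ-fromℕ< j<ℓ ⟩
      pw G i     ≡⟨ cong (pw G) v∈i ⟨
      w G v      ≡⟨ share-T Y v∈Y ⟨
      share Y v  ∎)
      where
      open ≡-Reasoning
      v∈Y : T (Y v)
      v∈Y = T-≡ .from (¬-not λ v∉Y →
        none (v , trans (cong toℕ v∈i) (toℕ-fromℕ< j<ℓ) , v∉Y))
    full : k ≤ wt Y
    full = begin
      k                               ≤⟨ P3 i ⟩
      partSize G i                    ≤⟨ m≤n*m _ (pwℕ j) {{>-nonZero a>0}} ⟩
      pwℕ j * partSize G i            ≤⟨ *-length-filter≤sum (λ v → part G v ≟ i)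
                                           (share Y) pwℕ≤share (allFin n) ⟩
      sum (map (share Y) (allFin n))  ≡⟨ sum-map-tabulate (share Y) id ⟩
      wt Y                            ∎
      where open ≤-Reasoning

  pwℕ≤β : 0 < k → ∀ {j} → j < ℓ → pwℕ j ≤ β
  pwℕ≤β k>0 {j} j<ℓ with 0 <? pwℕ j
  ... | no  a≯0 = ≤-trans (≮⇒≥ a≯0) z≤n
  ... | yes a>0 with unfilled-part ∅ j<ℓ a>0 (subst (_< k) (sym wt-∅) k>0)
  ...   | x , refl , _ = subst (_≤ β) (sym (pwℕ-rank x)) (w≤β x)

  gcdBelow≤β : 0 < k → ∀ {j} → j ≤ ℓ → 0 < gcdBelow j → gcdBelow j ≤ β
  gcdBelow≤β k>0 {j} j≤ℓ = prefixGcd-≤ pwℕ j λ i i<j → pwℕ≤β k>0 (<-≤-trans i<j j≤ℓ)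

  -- Every vertex of D(x) other than x lies in a lower part.
  extend : ∀ Y x → Y x ≡ false →
           Σ ℕ λ e → wt (Y ∪ desc x) ≡ wt Y + w G x + e × gcdBelow (rank x) ∣ e
  extend Y x x∉Y = e , weight-eq , proj₂ (proj₂ removed)
    where
    new = desc x ∖ Y
    below : ∀ v → v ≢ x → gcdBelow (rank x) ∣ share new v
    below v v≢x = share-∣ new v λ v∈new → subst (gcdBelow (rank x) ∣_) (pwℕ-rank v)
      (prefixGcd-∣ pwℕ (rank-< (toWitness (proj₂ (T-∧ {not (Y v)} .to v∈new))) (≢-sym v≢x)))
    removed = ∑-remove-∣ (share new) x below
    e = proj₁ removed
    x∈new : T (new x)
    x∈new = T-∧ .from (T-not-≡ .from x∉Y , fromWitness ε)
    weight-eq : wt (Y ∪ desc x) ≡ wt Y + w G x + e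
    weight-eq = begin
      wt (Y ∪ desc x)            ≡⟨ wt-∪ Y (desc x) ⟩
      wt Y + wt new              ≡⟨ cong (wt Y +_) (proj₁ (proj₂ removed)) ⟩
      wt Y + (share new x + e)   ≡⟨ cong (λ t → wt Y + (t + e)) (share-T new x∈new) ⟩
      wt Y + (w G x + e)         ≡⟨ +-assoc (wt Y) (w G x) e ⟨
      wt Y + w G x + e           ∎
      where open ≡-Reasoning

  wt-∪-desc≤ : ∀ Y x → wt (Y ∪ desc x) ≤ wt Y + β
  wt-∪-desc≤ Y x = subst (_≤ wt Y + β) (sym (wt-∪ Y (desc x)))
    (+-monoʳ-≤ (wt Y) (≤-trans (wt-∖≤ (desc x) Y) (wt-desc≤β x)))

  grow : ∀ {j} Y → j < ℓ → 0 < pwℕ j → wt Y < k →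
         Σ (Fin n) λ x → Σ ℕ λ e → wt (Y ∪ desc x) ≡ wt Y + pwℕ j + e × gcdBelow j ∣ e
  grow Y j<ℓ a>0 wtY<k with unfilled-part Y j<ℓ a>0 wtY<k
  ... | x , refl , x∉Y with extend Y x x∉Y
  ...   | e , weight-eq , g∣e =
    x , e , trans weight-eq (cong (λ a → wt Y + a + e) (sym (pwℕ-rank x))) , g∣e

  module Greedy (k>0 : 0 < k) (d∣k : gcdBelow ℓ ∣ k) where

    d : ℕ
    d = gcdBelow ℓ

    instance
      d≢0 : NonZero d
      d≢0 = ≢-nonZero λ d≡0 → <⇒≢ k>0 (sym (0∣⇒≡0 (subst (_∣ k) d≡0 d∣k)))

    steps≤β : ∀ {j} t → j ≤ ℓ → 0 < gcdBelow j → suc t * d ≤ gcdBelow j → t ≤ β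
    steps≤β t j≤ℓ pos bound =
      ≤-trans (n≤1+n t) (≤-trans (m≤m*n _ d) (≤-trans bound (gcdBelow≤β k>0 j≤ℓ pos)))

    -- The parts from j on are settled except for c more vertices of part j, and the
    -- rest of k is a multiple M of gcdBelow j. Y is a union of `steps` descendant
    -- sets; the bound on `steps` is what keeps every later step below k.
    record Progress (j c : ℕ) : Set where
      field
        Y       : Fin n → Bool
        closed  : Closedᵇ Y
        steps   : ℕ
        M       : ℕ
        balance : k ≡ wt Y + (c * pwℕ j + M * gcdBelow j)
        within  : 0 < gcdBelow j → wt Y ≤ steps * β × suc (steps + c) * d ≤ gcdBelow j

    start : Progress ℓ 0
    start = record
      { Y       = ∅
      ; closed  = λ _ _ _ ()
      ; steps   = 0
      ; M       = quotient
      ; balance = trans equality (cong (_+ quotient * d) (sym wt-∅))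
      ; within  = λ _ → ≤-reflexive wt-∅ , ≤-reflexive (+-identityʳ d)
      }
      where open _∣_ d∣k

    skip : ∀ {j c} → pwℕ j ≡ 0 → Progress j (suc c) → Progress j c
    skip {j} {c} a≡0 p = record
      { Y       = Y
      ; closed  = closed
      ; steps   = steps
      ; M       = M
      ; balance = subst (λ a → k ≡ wt Y + (suc c * a + M * g) → k ≡ wt Y + (c * a + M * g))
                    (sym a≡0) id balance
      ; within  = λ pos → proj₁ (within pos) ,
                    ≤-trans (*-monoˡ-≤ d (s≤s (+-monoʳ-≤ steps (n≤1+n c)))) (proj₂ (within pos))
      }
      where
      open Progress p
      g = gcdBelow j

    light : ∀ {j c} → 0 < pwℕ j → (p : Progress j (suc c)) → wt (Progress.Y p) < k
    light {j} a>0 p = subst (wt Y <_) (sym balance)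
      (m<m+n (wt Y) (<-≤-trans a>0 (≤-trans (m≤m+n (pwℕ j) _) (m≤m+n _ _))))
      where open Progress p

    absorb : ∀ {j c} (p : Progress j (suc c)) x {e} → j < ℓ →
             wt (Progress.Y p ∪ desc x) ≡ wt (Progress.Y p) + pwℕ j + e → gcdBelow j ∣ e →
             Progress j c
    absorb {j} {c} p x {e} j<ℓ weight-eq g∣e = record
      { Y       = Y′
      ; closed  = ∪-closed closed (desc-closed x)
      ; steps   = suc steps
      ; M       = M′
      ; balance = balance′
      ; within  = λ pos → wtY′≤ pos , bound pos
      }
      where
      open Progress p
      Y′ = Y ∪ desc x
      a = pwℕ j
      g = gcdBelow j
      bound : 0 < g → suc (suc steps + c) * d ≤ g
      bound pos = subst (λ t → suc t * d ≤ g) (+-suc steps c) (proj₂ (within pos))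
      wtY′≤ : 0 < g → wt Y′ ≤ suc steps * β
      wtY′≤ pos = begin
        wt Y′             ≤⟨ wt-∪-desc≤ Y x ⟩
        wt Y + β          ≤⟨ +-monoˡ-≤ β (proj₁ (within pos)) ⟩
        steps * β + β     ≡⟨ +-comm (steps * β) β ⟩
        suc steps * β     ∎
        where open ≤-Reasoning
      fits : 0 < g → wt Y′ + c * a ≤ k
      fits pos = begin
        wt Y′ + c * a             ≤⟨ +-mono-≤ (wtY′≤ pos) (*-monoʳ-≤ c (pwℕ≤β k>0 j<ℓ)) ⟩
        suc steps * β + c * β     ≡⟨ *-distribʳ-+ β (suc steps) c ⟨
        (suc steps + c) * β       ≤⟨ budget (steps≤β (suc steps + c) (<⇒≤ j<ℓ) pos (bound pos)) ⟩
        k                         ∎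
        where open ≤-Reasoning
      e≤M*g : 0 < g → e ≤ M * g
      e≤M*g pos = +-cancelˡ-≤ (wt Y + suc c * a) e (M * g) (subst₂ _≤_
        (trans (cong (_+ c * a) weight-eq) (shuffle (wt Y) a e (c * a)))
        (trans balance (sym (+-assoc (wt Y) _ _))) (fits pos))
        where
        shuffle : ∀ y a e ca → y + a + e + ca ≡ y + (a + ca) + e
        shuffle = solve-∀
      split = ∣∧≤⇒≡+* {M = M} g∣e e≤M*g
      M′ = proj₁ split
      balance′ : k ≡ wt Y′ + (c * a + M′ * g)
      balance′ = begin
        k                                  ≡⟨ balance ⟩
        wt Y + (suc c * a + M * g)         ≡⟨ cong (λ t → wt Y + (suc c * a + t)) (proj₂ split) ⟩
        wt Y + (a + c * a + (e + M′ * g))  ≡⟨ regroup (wt Y) a (c * a) e (M′ * g) ⟩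
        wt Y + a + e + (c * a + M′ * g)    ≡⟨ cong (_+ (c * a + M′ * g)) weight-eq ⟨
        wt Y′ + (c * a + M′ * g)           ∎
        where
        open ≡-Reasoning
        regroup : ∀ y a ca e m → y + (a + ca + (e + m)) ≡ y + a + e + (ca + m)
        regroup = solve-∀

    fill-one : ∀ {j c} → j < ℓ → Progress j (suc c) → Progress j c
    fill-one {j} j<ℓ p with 0 <? pwℕ j
    ... | no  a≯0 = skip (n≤0⇒n≡0 (≮⇒≥ a≯0)) p
    ... | yes a>0 with grow (Progress.Y p) j<ℓ a>0 (light a>0 p)
    ...   | x , e , weight-eq , g∣e = absorb p x j<ℓ weight-eq g∣e

    fill : ∀ {j} → j < ℓ → ∀ c → Progress j c → Progress j 0
    fill j<ℓ zero    p = p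
    fill j<ℓ (suc c) p = fill j<ℓ c (fill-one j<ℓ p)

    descend : ∀ {j} → j < ℓ → Progress (suc j) 0 → Σ ℕ (Progress j)
    descend {j} j<ℓ p = c , record
      { Y       = Y
      ; closed  = closed
      ; steps   = steps
      ; M       = proj₁ (decompose c*a≤m*g)
      ; balance = trans balance (cong (wt Y +_) (proj₂ (decompose c*a≤m*g)))
      ; within  = λ pos → proj₁ (within (g>0 pos)) , bound pos
      }
      where
      open Progress p renaming (M to m)
      a = pwℕ j
      g = gcdBelow (suc j)
      residue = gcd-residue (gcdBelow j) a m
      c = proj₁ residue
      decompose = proj₂ (proj₂ residue)
      g>0 : 0 < gcdBelow j → 0 < g
      g>0 pos = n≢0⇒n>0 (gcd[m,n]≢0 (gcdBelow j) a (inj₁ (n>0⇒n≢0 pos)))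
      bound : 0 < gcdBelow j → suc (steps + c) * d ≤ gcdBelow j
      bound pos = begin
        (suc steps + c) * d      ≡⟨ *-distribʳ-+ d (suc steps) c ⟩
        suc steps * d + c * d    ≤⟨ +-mono-≤ steps*d≤g (*-monoʳ-≤ c d≤g) ⟩
        g + c * g                ≤⟨ proj₁ (proj₂ residue) pos ⟩
        gcdBelow j               ∎
        where
        open ≤-Reasoning
        steps*d≤g : suc steps * d ≤ g
        steps*d≤g = subst (λ t → suc t * d ≤ g) (+-identityʳ steps) (proj₂ (within (g>0 pos)))
        d≤g : d ≤ g
        d≤g = ∣⇒≤ {{>-nonZero (g>0 pos)}} (prefixGcd-antitone pwℕ j<ℓ)
      c*a≤m*g : 0 < gcdBelow j → c * a ≤ m * g
      c*a≤m*g pos = +-cancelˡ-≤ (wt Y) _ _ (begin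
        wt Y + c * a          ≤⟨ +-mono-≤ (proj₁ (within (g>0 pos))) (*-monoʳ-≤ c (pwℕ≤β k>0 j<ℓ)) ⟩
        steps * β + c * β     ≡⟨ *-distribʳ-+ β steps c ⟨
        (steps + c) * β       ≤⟨ budget (steps≤β (steps + c) (<⇒≤ j<ℓ) pos (bound pos)) ⟩
        k                     ≡⟨ balance ⟩
        wt Y + m * g          ∎)
        where open ≤-Reasoning

    settle : ∀ j → j ≤ ℓ → Progress j 0 → Progress 0 0
    settle zero    _   p = p
    settle (suc j) j<ℓ p with descend j<ℓ p
    ... | c , q = settle j (<⇒≤ j<ℓ) (fill j<ℓ c q)

    closed-set : Σ (Fin n → Bool) λ Y → Closedᵇ Y × wt Y ≡ k
    closed-set = Y , closed , sym (begin
      k                          ≡⟨ balance ⟩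
      wt Y + (0 + M * 0)         ≡⟨ cong (wt Y +_) (*-zeroʳ M) ⟩
      wt Y + 0                   ≡⟨ +-identityʳ (wt Y) ⟩
      wt Y                       ∎)
      where
      open Progress (settle ℓ ≤-refl start)
      open ≡-Reasoning

  closed-of-weight : gcdW G ∣ k → Σ (Fin n → Bool) λ Y → Closedᵇ Y × wt Y ≡ k
  closed-of-weight gcdW∣k with 0 <? k
  ... | no  k≯0 = ∅ , (λ _ _ _ ()) , trans wt-∅ (sym (n≤0⇒n≡0 (≮⇒≥ k≯0)))
  ... | yes k>0 = Greedy.closed-set k>0 (∣-trans gcdBelow-ℓ∣gcdW gcdW∣k)

mainTheorem2 : ∀ {n ℓ : ℕ} (G : PartitionedGraph n ℓ) (k : ℕ) → IsFrobenius G k →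
    ((Σ (Subset n) λ S → Closed G S × weight G S ≡ k) ⇔ (gcdW G ∣ k))
mainTheorem2 {n} G k F = mk⇔ necessary sufficient
  where
  open Frobenius G k F
  necessary : (Σ (Subset n) λ S → Closed G S × weight G S ≡ k) → gcdW G ∣ k
  necessary (S , _ , weight≡k) = subst (gcdW G ∣_) weight≡k (gcdW∣weight S)
  sufficient : gcdW G ∣ k → Σ (Subset n) λ S → Closed G S × weight G S ≡ k
  sufficient gcdW∣k with closed-of-weight gcdW∣k
  ... | Y , Y-closed , wt≡k =
    toSubset Y , toSubset-closed Y Y-closed , trans (weight-toSubset Y) wt≡k
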